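{- Let $k\ge 1$ and $r\ge 2$ be integers and let $H=H^{(k,r)}$. Consider two variables $x_{\sigma,\tau}$ and $x_{\sigma',\tau'}$ (with $\sigma,\sigma'\in[2]^k$, $\tau,\tau'\in[r]^k$). If the product $x_{\sigma,\tau}x_{\sigma',\tau'}$ divides some monomial of $H$, and if $\sigma$ and $\sigma'$ have a common prefix of length $\ell<k$, then $\tau$ and $\tau'$ have a common prefix of length $\ell+1$.
   Context: For integers $k\ge1$, $r\ge2$, the polynomial $H^{(k,r)}$ is defined over the $(2r)^k$ variables $\{x_{\sigma,\tau}: \sigma\in[2]^k,\ \tau\in[r]^k\}$ as follows. For words $u\in[2]^{\le k}$, $v\in[r]^{\le k}$ with $|u|=|v|$, define recursively $H_{u,v}=x_{u,v}$ if $|u|=|v|=k$, and otherwise $H_{u,v}=\sum_{a=1}^{r}H_{u1,va}\,H_{u2,va}$ (where $u1$ denotes the word $u$ followed by the letter $1$, etc.). Then $H^{(k,r)}=H_{\varepsilon,\varepsilon}$ where $\varepsilon$ is the empty word. It is a polynomial of degree $2^k$ with $r^{2^k-1}$ monomials. -}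

module Defs where

open import Data.Nat using (ℕ; zero; suc)
open import Data.Fin using (Fin)
open import Data.List using (List; []; _∷_; _++_; [_]; concatMap; allFin)
open import Data.List.Relation.Binary.Permutation.Propositional using (_↭_)
open import Data.Product using (_×_; _,_; ∃)

-- Words over [2] = Fin 2 (letter 1 = zero, letter 2 = suc zero) and over [r] = Fin r.
-- A variable x_{u,v} is indexed by a pair of words.
Var : ℕ → Set
Var r = List (Fin 2) × List (Fin r)

-- A monomial is a finite multiset of variables, represented by a list
-- (two monomials are equal iff the lists are permutations of each other).
Monomial : ℕ → Set
Monomial r = List (Var r)

-- A polynomial with natural-number coefficients, written as a formal sum of
-- monomials (the coefficient of a monomial = number of occurrences up to ↭).
Poly : ℕ → Set
Poly r = List (Monomial r)

_⊗_ : ∀ {r} → Poly r → Poly r → Poly r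
p ⊗ q = concatMap (λ m₁ → Data.List.map (λ m₂ → m₁ ++ m₂) q) p

letter1 letter2 : Fin 2
letter1 = Fin.zero
letter2 = Fin.suc Fin.zero

-- Hrec d u v = H_{u,v} where d = k - |u| is the remaining depth:
--   H_{u,v} = x_{u,v}                                  if d = 0
--   H_{u,v} = Σ_{a=1}^{r} H_{u1,va} · H_{u2,va}          otherwise
Hrec : (r : ℕ) → ℕ → List (Fin 2) → List (Fin r) → Poly r
Hrec r zero    u v = [ [ (u , v) ] ]
Hrec r (suc d) u v =
  concatMap (λ a → Hrec r d (u ++ [ letter1 ]) (v ++ [ a ])
                 ⊗ Hrec r d (u ++ [ letter2 ]) (v ++ [ a ]))
            (allFin r)

H : (k r : ℕ) → Poly r
H k r = Hrec r k [] []

_∣ₘ_ : ∀ {r} → Monomial r → Monomial r → Set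
m₁ ∣ₘ m₂ = ∃ λ m' → (m₁ ++ m') ↭ m₂

{-# OPTIONS --safe #-}
-- Every monomial of H_{u,v} is a product of one monomial of H_{u1,va} and one of
-- H_{u2,va}. Variables from the two factors have first components extending u1 and
-- u2 and second components extending va, so their first components agree on at
-- most |u| = |v| letters, while their second components agree on |v| + 1 letters.
module Submission where

open import Defs
open import Data.Nat using (ℕ; zero; suc; _≤_; _<_; _+_; z≤n; s≤s)
open import Data.Fin using (Fin)
open import Data.Vec using (Vec; toList)
open import Data.List using (List; []; _∷_; _++_; [_]; take; length; map; allFin)
open import Data.List.Properties using (++-assoc; ++-identityʳ; length-++; ∷-injective)
open import Data.List.Membership.Propositional using (_∈_; find)
open import Data.List.Membership.Propositional.Properties using (∈-concatMap⁻; ∈-map⁻)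
open import Data.List.Relation.Unary.Any using (here; satisfied)
open import Data.List.Relation.Unary.All as All using (All; []; _∷_)
open import Data.List.Relation.Unary.All.Properties as All using ()
open import Data.List.Relation.Unary.AllPairs using (AllPairs; []; _∷_)
open import Data.List.Relation.Unary.AllPairs.Properties as AllPairs using ()
open import Data.List.Relation.Binary.Permutation.Propositional using (↭-sym; ↭⇒↭ₛ)
open import Data.List.Relation.Binary.Permutation.Setoid.Properties using (AllPairs-resp-↭)
open import Data.Product using (_×_; _,_; ∃; proj₁; proj₂)
open import Level using (0ℓ)
open import Relation.Binary.Core using (Rel)
open import Relation.Binary.Definitions using (Symmetric)
open import Relation.Binary.PropositionalEquality
  using (_≡_; _≢_; refl; sym; trans; cong; resp₂; setoid)
open import Relation.Nullary using (contradiction)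
open import Relation.Unary using (Pred)

module _ {A : Set} where

  take-≡⇒≤-length : ∀ {a b} (u : List A) s s′ ℓ → a ≢ b →
                    take ℓ (u ++ a ∷ s) ≡ take ℓ (u ++ b ∷ s′) → ℓ ≤ length u
  take-≡⇒≤-length u       s s′ zero    _   _  = z≤n
  take-≡⇒≤-length []      s s′ (suc ℓ) a≢b eq = contradiction (proj₁ (∷-injective eq)) a≢b
  take-≡⇒≤-length (x ∷ u) s s′ (suc ℓ) a≢b eq =
    s≤s (take-≡⇒≤-length u s s′ ℓ a≢b (proj₂ (∷-injective eq)))

  take-suc-shared : ∀ (v : List A) c t t′ {ℓ} → ℓ ≤ length v →
                    take (suc ℓ) (v ++ c ∷ t) ≡ take (suc ℓ) (v ++ c ∷ t′)
  take-suc-shared []      c t t′ z≤n     = refl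
  take-suc-shared (x ∷ v) c t t′ z≤n     = refl
  take-suc-shared (x ∷ v) c t t′ (s≤s p) = cong (x ∷_) (take-suc-shared v c t t′ p)

module _ {r : ℕ} where

  ∈-⊗⁻ : ∀ {m} (p q : Poly r) → m ∈ p ⊗ q →
         ∃ λ m₁ → ∃ λ m₂ → m₁ ∈ p × m₂ ∈ q × m ≡ m₁ ++ m₂
  ∈-⊗⁻ p q m∈ with find (∈-concatMap⁻ (λ m₁ → map (m₁ ++_) q) {xs = p} m∈)
  ... | m₁ , m₁∈p , m∈m₁q with ∈-map⁻ (m₁ ++_) m∈m₁q
  ... | m₂ , m₂∈q , refl = m₁ , m₂ , m₁∈p , m₂∈q , refl

  AllPairs-∣ₘ : ∀ {R : Rel (Var r) 0ℓ} → Symmetric R → ∀ {x y m} →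
                AllPairs R m → (x ∷ y ∷ []) ∣ₘ m → R x y
  AllPairs-∣ₘ {R} R-sym pairs (_ , x∷y∷rest↭m)
    with AllPairs-resp-↭ (setoid (Var r)) R-sym (resp₂ R) (↭⇒↭ₛ (↭-sym x∷y∷rest↭m)) pairs
  ... | (Rxy ∷ _) ∷ _ = Rxy

  Linked : Rel (Var r) 0ℓ
  Linked (σ , τ) (σ′ , τ′) = ∀ ℓ → take ℓ σ ≡ take ℓ σ′ → take (suc ℓ) τ ≡ take (suc ℓ) τ′

  Linked-sym : Symmetric Linked
  Linked-sym xy ℓ eq = sym (xy ℓ (sym eq))

  Extends : List (Fin 2) → List (Fin r) → Pred (Var r) 0ℓ
  Extends u v (σ , τ) = (∃ λ s → σ ≡ u ++ s) × (∃ λ t → τ ≡ v ++ t)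

  Extends-refl : ∀ u v → Extends u v (u , v)
  Extends-refl u v = ([] , sym (++-identityʳ u)) , ([] , sym (++-identityʳ v))

  Extends-∷ʳ⁻ : ∀ u v a c {x} → Extends (u ++ [ a ]) (v ++ [ c ]) x → Extends u v x
  Extends-∷ʳ⁻ u v a c ((s , refl) , (t , refl)) =
    (a ∷ s , ++-assoc u [ a ] s) , (c ∷ t , ++-assoc v [ c ] t)

  Linked-across : ∀ u v c {x y} → length u ≡ length v →
                  Extends (u ++ [ letter1 ]) (v ++ [ c ]) x →
                  Extends (u ++ [ letter2 ]) (v ++ [ c ]) y → Linked x y
  Linked-across u v c |u|≡|v| ((s , refl) , (t , refl)) ((s′ , refl) , (t′ , refl)) ℓ σ≡σ′
    rewrite ++-assoc u [ letter1 ] s | ++-assoc u [ letter2 ] s′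
          | ++-assoc v [ c ] t       | ++-assoc v [ c ] t′
    = take-suc-shared v c t t′ ℓ≤|v|
    where
    ℓ≤|v| : ℓ ≤ length v
    ℓ≤|v| with take-≡⇒≤-length u s s′ ℓ (λ ()) σ≡σ′
    ... | ℓ≤|u| rewrite |u|≡|v| = ℓ≤|u|

  length-∷ʳ-≡ : ∀ (u : List (Fin 2)) (v : List (Fin r)) a c →
                length u ≡ length v → length (u ++ [ a ]) ≡ length (v ++ [ c ])
  length-∷ʳ-≡ u v a c |u|≡|v| =
    trans (length-++ u) (trans (cong (_+ 1) |u|≡|v|) (sym (length-++ v)))

  Hrec-linked : ∀ d u v {m} → length u ≡ length v → m ∈ Hrec r d u v →
                All (Extends u v) m × AllPairs Linked m
  Hrec-linked zero    u v |u|≡|v| (here refl) = (Extends-refl u v ∷ []) , ([] ∷ [])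
  Hrec-linked (suc d) u v |u|≡|v| m∈
    with satisfied (∈-concatMap⁻ _ {xs = allFin r} m∈)
  ... | c , m∈⊗ with ∈-⊗⁻ (Hrec r d (u ++ [ letter1 ]) (v ++ [ c ]))
                          (Hrec r d (u ++ [ letter2 ]) (v ++ [ c ])) m∈⊗
  ... | m₁ , m₂ , m₁∈ , m₂∈ , refl
    with Hrec-linked d (u ++ [ letter1 ]) (v ++ [ c ]) (length-∷ʳ-≡ u v letter1 c |u|≡|v|) m₁∈
       | Hrec-linked d (u ++ [ letter2 ]) (v ++ [ c ]) (length-∷ʳ-≡ u v letter2 c |u|≡|v|) m₂∈
  ... | ext₁ , linked₁ | ext₂ , linked₂ =
    All.++⁺ (All.map (Extends-∷ʳ⁻ u v letter1 c) ext₁)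
            (All.map (Extends-∷ʳ⁻ u v letter2 c) ext₂) ,
    AllPairs.++⁺ linked₁ linked₂
      (All.map (λ x∈₁ → All.map (Linked-across u v c |u|≡|v| x∈₁) ext₂) ext₁)

  H-linked : ∀ k {m} → m ∈ H k r → AllPairs Linked m
  H-linked k m∈ = proj₂ (Hrec-linked k [] [] refl m∈)

proposition4p2 : (k r : ℕ) → 1 ≤ k → 2 ≤ r →
    (σ σ′ : Vec (Fin 2) k) (τ τ′ : Vec (Fin r) k) (ℓ : ℕ) →
    (∃ λ m → m ∈ H k r × (((toList σ , toList τ) ∷ (toList σ′ , toList τ′) ∷ []) ∣ₘ m)) →
    ℓ < k →
    take ℓ (toList σ) ≡ take ℓ (toList σ′) →
    take (suc ℓ) (toList τ) ≡ take (suc ℓ) (toList τ′)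
proposition4p2 k r _ _ σ σ′ τ τ′ ℓ (m , m∈H , pair∣m) _ =
  AllPairs-∣ₘ Linked-sym (H-linked k m∈H) pair∣m ℓ
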